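{- Let $k$ be a positive integer, $a=3k+1$ and $S=\{a,2a-3,2a-2\}=\{3k+1,6k-1,6k\}$. Then the numerical semigroup $\langle S\rangle$ is a $3$-permutation numerical semigroup.
   Context: A numerical semigroup is a submonoid $G$ of $(\mathbb{N},+,0)$ with $\mathbb{N}\setminus G$ finite; $\langle S\rangle$ is the submonoid generated by $S$. Write the elements of $G$ as $0=g_0<g_1<g_2<\cdots$. For $n\ge 1$, $G$ is an $n$-permutation numerical semigroup if $G=\langle g_1,\dots,g_n\rangle$ and for every integer $k\ge 0$ the tuple $(g_{kn+1}\bmod n,\dots,g_{kn+n}\bmod n)$ contains exactly one representative of each residue class of $\mathbb{Z}/n\mathbb{Z}$. -}

module Defs where

open import Data.Nat using (ℕ; zero; suc; _+_; _*_; _∸_; _<_; _≤_; NonZero)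
open import Data.Nat.DivMod using (_%_)
open import Data.Fin using (Fin; toℕ)
open import Data.List using (List)
open import Data.List.Membership.Propositional using (_∈_)
open import Data.Product using (Σ; ∃; _×_; _,_)
open import Relation.Binary.PropositionalEquality using (_≡_)

Subsetℕ : Set₁
Subsetℕ = ℕ → Set

data ⟨_⟩ (S : List ℕ) : ℕ → Set where
  gen-zero : ⟨ S ⟩ 0
  gen-add  : ∀ {s x} → s ∈ S → ⟨ S ⟩ x → ⟨ S ⟩ (s + x)

IsSubmonoid : Subsetℕ → Set
IsSubmonoid G = G 0 × (∀ x y → G x → G y → G (x + y))

-- G is a numerical semigroup: submonoid with finite complement
-- (equivalently: all sufficiently large naturals lie in G).
IsNumericalSemigroup : Subsetℕ → Set
IsNumericalSemigroup G = IsSubmonoid G × ∃ λ F → ∀ x → F ≤ x → G x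

-- g enumerates G in increasing order: g 0 < g 1 < g 2 < ... and
-- {g i | i ∈ ℕ} = G.  (Then g 0 = 0 when G is a submonoid.)
IsIncreasingEnumeration : Subsetℕ → (ℕ → ℕ) → Set
IsIncreasingEnumeration G g =
  (∀ i → g i < g (suc i)) × (∀ i → G (g i)) × (∀ x → G x → ∃ λ i → g i ≡ x)

firstGens : (ℕ → ℕ) → ℕ → List ℕ
firstGens g n = go n
  where
  go : ℕ → List ℕ
  go zero = Data.List.[]
  go (suc m) = go m Data.List.++ (g (suc m) Data.List.∷ Data.List.[])

∃!Fin : (n : ℕ) → (Fin n → Set) → Set
∃!Fin n P = Σ (Fin n) λ j → P j × (∀ j' → P j' → j' ≡ j)

IsNPermutationNS : (n : ℕ) → .{{NonZero n}} → Subsetℕ → Set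
IsNPermutationNS n G =
  IsNumericalSemigroup G ×
  Σ (ℕ → ℕ) λ g →
    IsIncreasingEnumeration G g ×
    (∀ x → (G x → ⟨ firstGens g n ⟩ x) × (⟨ firstGens g n ⟩ x → G x)) ×
    (∀ k → (r : Fin n) →
       ∃!Fin n λ j → g (k * n + suc (toℕ j)) % n ≡ toℕ r)

{-# OPTIONS --safe #-}
-- Write y ∈ G = ⟨a, 2a − 3, 2a − 2⟩, a = 3k + 1, as y = N·a − D: the generators contribute
-- (1, 0), (2, 3) and (2, 2) to (N, D), so the deficits at level N are {0} ∪ [2, 3⌊N/2⌋].
-- For n < 2k no element of level N ≥ n + 2 lies below (n+1)·a, hence G ∩ [n·a, (n+1)·a)
-- is n·a followed by the 3⌈n/2⌉ − 1 integers up to (n+1)·a − 2, while from 2k·a on G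
-- contains everything. So the enumeration cuts into triples that never straddle two such
-- blocks: the first triple of a block, n·a and (n+1)·a − 3⌈n/2⌉ and its successor, has
-- residues n, n + 1, n + 2 modulo 3 because a ≡ 1, and every other triple consists of
-- three consecutive integers.
module Submission where

open import Defs
open import Data.Nat using (ℕ; zero; suc; _+_; _*_; _∸_; _≤_; _<_; z≤n; s≤s; s≤s⁻¹; ⌊_/2⌋; ⌈_/2⌉; NonZero; >-nonZero; _<?_)
open import Data.Nat.Properties
open import Data.Nat.DivMod using (_%_; _/_; %-distribˡ-+; m%n%n≡m%n; m%n<n; m<n⇒m%n≡m; [m+n]%n≡m%n; [m+kn]%n≡m%n; m≡m%n+[m/n]*n)
open import Data.Nat.Tactic.RingSolver using (solve-∀)
open import Data.Fin using (Fin; zero; suc; toℕ; fromℕ<)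
open import Data.Fin.Properties using (toℕ-injective; toℕ-fromℕ<; toℕ<n)
open import Data.List using (List; _∷_; [])
open import Data.List.Membership.Propositional using (_∈_)
open import Data.List.Relation.Unary.Any using (here; there)
open import Data.Product using (∃; ∃-syntax; ∃₂; _×_; _,_; proj₁; proj₂)
open import Relation.Nullary using (¬_; yes; no; contradiction)
open import Relation.Binary.PropositionalEquality
open import Relation.Binary.Definitions using (tri<; tri≈; tri>)
open import Function using (_∘_)

module _ {S : List ℕ} where

  ⟨⟩-+ : ∀ {x y} → ⟨ S ⟩ x → ⟨ S ⟩ y → ⟨ S ⟩ (x + y)
  ⟨⟩-+ gen-zero                      y∈ = y∈
  ⟨⟩-+ {y = y} (gen-add {s} {x} s∈S x∈) y∈ =
    subst ⟨ S ⟩ (sym (+-assoc s x y)) (gen-add s∈S (⟨⟩-+ x∈ y∈))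

  ⟨⟩-* : ∀ {s} → s ∈ S → ∀ m → ⟨ S ⟩ (m * s)
  ⟨⟩-* s∈S zero    = gen-zero
  ⟨⟩-* s∈S (suc m) = gen-add s∈S (⟨⟩-* s∈S m)

  ⟨⟩-isSubmonoid : IsSubmonoid ⟨ S ⟩
  ⟨⟩-isSubmonoid = gen-zero , λ _ _ → ⟨⟩-+

2*⌊n/2⌋≤n : ∀ n → 2 * ⌊ n /2⌋ ≤ n
2*⌊n/2⌋≤n n = begin
  2 * ⌊ n /2⌋          ≡⟨ cong (⌊ n /2⌋ +_) (+-identityʳ ⌊ n /2⌋) ⟩
  ⌊ n /2⌋ + ⌊ n /2⌋    ≤⟨ +-monoʳ-≤ ⌊ n /2⌋ (⌊n/2⌋≤⌈n/2⌉ n) ⟩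
  ⌊ n /2⌋ + ⌈ n /2⌉    ≡⟨ ⌊n/2⌋+⌈n/2⌉≡n n ⟩
  n                    ∎
  where open ≤-Reasoning

2*m≤n⇒m≤⌊n/2⌋ : ∀ {m n} → 2 * m ≤ n → m ≤ ⌊ n /2⌋
2*m≤n⇒m≤⌊n/2⌋ {m} 2m≤n = begin
  m                  ≡⟨ n≡⌊n+n/2⌋ m ⟩
  ⌊ m + m /2⌋        ≡⟨ cong (λ x → ⌊ m + x /2⌋) (+-identityʳ m) ⟨
  ⌊ 2 * m /2⌋        ≤⟨ ⌊n/2⌋-mono 2m≤n ⟩
  _                  ∎
  where open ≤-Reasoning

⌊1+2n/2⌋≡n : ∀ n → ⌊ suc (2 * n) /2⌋ ≡ n
⌊1+2n/2⌋≡n zero    = refl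
⌊1+2n/2⌋≡n (suc n) = begin
  ⌊ suc (2 * suc n) /2⌋         ≡⟨ cong (λ x → ⌊ suc x /2⌋) (*-suc 2 n) ⟩
  suc ⌊ suc (2 * n) /2⌋         ≡⟨ cong suc (⌊1+2n/2⌋≡n n) ⟩
  suc n                         ∎
  where open ≡-Reasoning

module _ (n : ℕ) .{{_ : NonZero n}} where

  private
    [m%n+o]%n≡[m+o]%n : ∀ m o → (m % n + o) % n ≡ (m + o) % n
    [m%n+o]%n≡[m+o]%n m o = begin
      (m % n + o) % n            ≡⟨ %-distribˡ-+ (m % n) o n ⟩
      (m % n % n + o % n) % n    ≡⟨ cong (λ x → (x + o % n) % n) (m%n%n≡m%n m n) ⟩
      (m % n + o % n) % n        ≡⟨ %-distribˡ-+ m o n ⟨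
      (m + o) % n                ∎
      where open ≡-Reasoning

    [m+o+[n∸m%n]]%n≡o%n : ∀ m o → (m + o + (n ∸ m % n)) % n ≡ o % n
    [m+o+[n∸m%n]]%n≡o%n m o = begin
      (m + o + d) % n                    ≡⟨ cong (λ x → (x + o + d) % n) (m≡m%n+[m/n]*n m n) ⟩
      (m % n + m / n * n + o + d) % n    ≡⟨ cong (_% n) (rearrange (m % n) (m / n * n) o d) ⟩
      (o + (m % n + d) + m / n * n) % n  ≡⟨ [m+kn]%n≡m%n (o + (m % n + d)) (m / n) n ⟩
      (o + (m % n + d)) % n              ≡⟨ cong (λ x → (o + x) % n) (m+[n∸m]≡n (<⇒≤ (m%n<n m n))) ⟩
      (o + n) % n                        ≡⟨ [m+n]%n≡m%n o n ⟩
      o % n                              ∎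
      where
      open ≡-Reasoning
      d = n ∸ m % n
      rearrange : ∀ r q o d → r + q + o + d ≡ o + (r + d) + q
      rearrange = solve-∀

  shifted-residues-exactly-once : ∀ m (f : Fin n → ℕ) → (∀ j → f j % n ≡ (m + toℕ j) % n) →
                              ∀ r → ∃!Fin n λ j → f j % n ≡ toℕ r
  shifted-residues-exactly-once m f f≡ r = j , f[j]≡r , unique
    where
    back : ℕ → ℕ
    back x = (x + (n ∸ m % n)) % n

    j : Fin n
    j = fromℕ< (m%n<n (toℕ r + (n ∸ m % n)) n)

    back-shift : ∀ (i : Fin n) → back ((m + toℕ i) % n) ≡ toℕ i
    back-shift i = begin
      ((m + toℕ i) % n + (n ∸ m % n)) % n   ≡⟨ [m%n+o]%n≡[m+o]%n (m + toℕ i) (n ∸ m % n) ⟩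
      (m + toℕ i + (n ∸ m % n)) % n         ≡⟨ [m+o+[n∸m%n]]%n≡o%n m (toℕ i) ⟩
      toℕ i % n                             ≡⟨ m<n⇒m%n≡m (toℕ<n i) ⟩
      toℕ i                                 ∎
      where open ≡-Reasoning

    f[j]≡r : f j % n ≡ toℕ r
    f[j]≡r = begin
      f j % n                              ≡⟨ f≡ j ⟩
      (m + toℕ j) % n                      ≡⟨ cong (λ x → (m + x) % n) (toℕ-fromℕ< _) ⟩
      (m + back (toℕ r)) % n               ≡⟨ cong (_% n) (+-comm m _) ⟩
      (back (toℕ r) + m) % n               ≡⟨ [m%n+o]%n≡[m+o]%n (toℕ r + (n ∸ m % n)) m ⟩
      (toℕ r + (n ∸ m % n) + m) % n        ≡⟨ cong (_% n) (solve-shuffle (toℕ r) (n ∸ m % n) m) ⟩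
      (m + toℕ r + (n ∸ m % n)) % n        ≡⟨ [m+o+[n∸m%n]]%n≡o%n m (toℕ r) ⟩
      toℕ r % n                            ≡⟨ m<n⇒m%n≡m (toℕ<n r) ⟩
      toℕ r                                ∎
      where
      open ≡-Reasoning
      solve-shuffle : ∀ x d y → x + d + y ≡ y + x + d
      solve-shuffle = solve-∀

    unique : ∀ i → f i % n ≡ toℕ r → i ≡ j
    unique i fi≡r = toℕ-injective (begin
      toℕ i                       ≡⟨ back-shift i ⟨
      back ((m + toℕ i) % n)      ≡⟨ cong back (trans (sym (f≡ i)) fi≡r) ⟩
      back (toℕ r)                ≡⟨ toℕ-fromℕ< _ ⟨
      toℕ j                       ∎)
      where open ≡-Reasoning

threes-and-twos : ∀ d p → 2 ≤ d → d ≤ 3 * p → ∃₂ λ i j → 3 * i + 2 * j ≡ d × i + j ≤ p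
threes-and-twos d zero 2≤d d≤0 = contradiction (≤-trans 2≤d d≤0) λ ()
threes-and-twos 1 (suc p) (s≤s ()) _
threes-and-twos 2 (suc p) _ _ = 0 , 1 , refl , s≤s z≤n
threes-and-twos 3 (suc p) _ _ = 1 , 0 , refl , s≤s z≤n
threes-and-twos 4 (suc zero) _ (s≤s (s≤s (s≤s ())))
threes-and-twos 4 (suc (suc p)) _ _ = 0 , 2 , refl , s≤s (s≤s z≤n)
threes-and-twos (suc (suc (suc (suc (suc d))))) (suc p) _ d≤3p
  with i , j , 3i+2j≡d , i+j≤p ← threes-and-twos (2 + d) p (s≤s (s≤s z≤n))
                                   (+-cancelˡ-≤ 3 _ _ (subst (5 + d ≤_) (*-suc 3 p) d≤3p))
  = suc i , j , trans (shift i j) (cong (3 +_) 3i+2j≡d) , s≤s i+j≤p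
  where
  shift : ∀ i j → 3 * suc i + 2 * j ≡ 3 + (3 * i + 2 * j)
  shift = solve-∀

Consecutive : (ℕ → Set) → ℕ → ℕ → Set
Consecutive G u v = u < v × (∀ w → u < w → w < v → ¬ G w)

module _ {G : ℕ → Set} where

  consecutive-suc : ∀ {u v} → v ≡ suc u → Consecutive G u v
  consecutive-suc refl = ≤-refl , λ w u<w w<1+u _ → <⇒≱ u<w (s≤s⁻¹ w<1+u)

  consecutive-skip : ∀ {u v} → v ≡ suc (suc u) → ¬ G (suc u) → Consecutive G u v
  consecutive-skip refl 1+u∉G =
    <-trans (n<1+n _) (n<1+n _) ,
    λ w u<w w<2+u w∈G → 1+u∉G (subst G (≤-antisym (s≤s⁻¹ w<2+u) u<w) w∈G)

  consecutive⇒enumeration : ∀ {g} → g 0 ≡ 0 → (∀ i → G (g i)) →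
                            (∀ i → Consecutive G (g i) (g (suc i))) → IsIncreasingEnumeration G g
  consecutive⇒enumeration {g} g0≡0 g∈G g-step = proj₁ ∘ g-step , g∈G , λ y y∈G →
    search (suc y) y∈G (≤-<-trans (i≤g y) (proj₁ (g-step y)))
    where
    i≤g : ∀ i → i ≤ g i
    i≤g zero    = z≤n
    i≤g (suc i) = ≤-trans (s≤s (i≤g i)) (proj₁ (g-step i))

    search : ∀ n {y} → G y → y < g n → ∃ λ i → g i ≡ y
    search zero    _   y<g0 = contradiction (subst (_ <_) g0≡0 y<g0) n≮0
    search (suc n) {y} y∈G y<g[1+n] with <-cmp y (g n)
    ... | tri< y<gn _ _  = search n y∈G y<gn
    ... | tri≈ _ y≡gn _  = n , sym y≡gn
    ... | tri> _ _ gn<y  = contradiction y∈G (proj₂ (g-step n) y gn<y y<g[1+n])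

module Interleaving (x y z : ℕ → ℕ) where

  entry : ℕ → ℕ → ℕ
  entry 0 m = x m
  entry 1 m = y m
  entry 2 m = z m
  entry (suc (suc (suc i))) m = entry i (suc m)

  enumeration : ℕ → ℕ
  enumeration zero    = 0
  enumeration (suc i) = entry i 0

  enumeration-block : ∀ m i → enumeration (m * 3 + suc i) ≡ entry i m
  enumeration-block m i = begin
    enumeration (m * 3 + suc i)   ≡⟨ cong enumeration (+-suc (m * 3) i) ⟩
    entry (m * 3 + i) 0           ≡⟨ shift m 0 ⟩
    entry i (m + 0)               ≡⟨ cong (entry i) (+-identityʳ m) ⟩
    entry i m                     ∎
    where
    open ≡-Reasoning
    shift : ∀ m c → entry (m * 3 + i) c ≡ entry i (m + c)
    shift zero    c = refl
    shift (suc m) c = trans (shift m (suc c)) (cong (entry i) (+-suc m c))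

  enumeration-consecutive : ∀ {G} → Consecutive G 0 (x 0) →
    (∀ m → Consecutive G (x m) (y m)) → (∀ m → Consecutive G (y m) (z m)) →
    (∀ m → Consecutive G (z m) (x (suc m))) →
    ∀ i → Consecutive G (enumeration i) (enumeration (suc i))
  enumeration-consecutive {G} 0→x x→y y→z z→x zero    = 0→x
  enumeration-consecutive {G} 0→x x→y y→z z→x (suc i) = entry-consecutive i 0
    where
    entry-consecutive : ∀ i m → Consecutive G (entry i m) (entry (suc i) m)
    entry-consecutive 0 m = x→y m
    entry-consecutive 1 m = y→z m
    entry-consecutive 2 m = z→x m
    entry-consecutive (suc (suc (suc i))) m = entry-consecutive i (suc m)

  enumeration-all : ∀ {P : ℕ → Set} → P 0 → (∀ m → P (x m)) → (∀ m → P (y m)) → (∀ m → P (z m)) →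
                    ∀ i → P (enumeration i)
  enumeration-all {P} P0 Px Py Pz zero    = P0
  enumeration-all {P} P0 Px Py Pz (suc i) = entry-all i 0
    where
    entry-all : ∀ i m → P (entry i m)
    entry-all 0 = Px
    entry-all 1 = Py
    entry-all 2 = Pz
    entry-all (suc (suc (suc i))) m = entry-all i (suc m)

  enumeration-residues : (∀ m → y m % 3 ≡ (x m + 1) % 3) → (∀ m → z m % 3 ≡ (x m + 2) % 3) →
    ∀ m (r : Fin 3) → ∃!Fin 3 λ j → enumeration (m * 3 + suc (toℕ j)) % 3 ≡ toℕ r
  enumeration-residues y≡ z≡ m =
    shifted-residues-exactly-once 3 (x m) (λ j → enumeration (m * 3 + suc (toℕ j))) λ j →
      trans (cong (_% 3) (enumeration-block m (toℕ j))) (entry≡ j)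
    where
    entry≡ : ∀ j → entry (toℕ j) m % 3 ≡ (x m + toℕ j) % 3
    entry≡ zero             = cong (_% 3) (sym (+-identityʳ (x m)))
    entry≡ (suc zero)       = y≡ m
    entry≡ (suc (suc zero)) = z≡ m

module Semigroup (k : ℕ) (1≤k : 1 ≤ k) where

  a b c : ℕ
  a = 3 * k + 1
  b = 6 * k ∸ 1
  c = 6 * k

  G : ℕ → Set
  G = ⟨ a ∷ b ∷ c ∷ [] ⟩

  0<a : 0 < a
  0<a = m≤n+m 1 (3 * k)

  instance
    a-nonZero : NonZero a
    a-nonZero = >-nonZero 0<a

  c+2≡2a : c + 2 ≡ 2 * a
  c+2≡2a = double k
    where
    double : ∀ k → 6 * k + 2 ≡ 2 * (3 * k + 1)
    double = solve-∀

  b+3≡2a : b + 3 ≡ 2 * a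
  b+3≡2a = begin
    6 * k ∸ 1 + 3        ≡⟨ +-assoc (6 * k ∸ 1) 1 2 ⟨
    6 * k ∸ 1 + 1 + 2    ≡⟨ cong (_+ 2) (m∸n+n≡m (≤-trans 1≤k (m≤n*m k 6))) ⟩
    6 * k + 2            ≡⟨ c+2≡2a ⟩
    2 * a                ∎
    where open ≡-Reasoning

  -- y = level·a − deficit: the generator a adds (1, 0) to (level, deficit), while
  -- 2a − 3 and 2a − 2 add (2, 3) and (2, 2); half counts the latter two.
  record LevelForm (y : ℕ) : Set where
    constructor level-form
    field
      level half deficit : ℕ
      2*half≤level      : 2 * half ≤ level
      deficit≤3*half    : deficit ≤ 3 * half
      deficit≢1         : deficit ≢ 1
      y+deficit≡level*a : y + deficit ≡ level * a

  2*deficit≤3*level : ∀ {y} (f : LevelForm y) → 2 * LevelForm.deficit f ≤ 3 * LevelForm.level f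
  2*deficit≤3*level (level-form N P D 2P≤N D≤3P _ _) = begin
    2 * D          ≤⟨ *-monoʳ-≤ 2 D≤3P ⟩
    2 * (3 * P)    ≡⟨ swap P ⟩
    3 * (2 * P)    ≤⟨ *-monoʳ-≤ 3 2P≤N ⟩
    3 * N          ∎
    where
    open ≤-Reasoning
    swap : ∀ P → 2 * (3 * P) ≡ 3 * (2 * P)
    swap = solve-∀

  private
    add-a : ∀ {y} → LevelForm y → LevelForm (a + y)
    add-a {y} (level-form N P D 2P≤N D≤3P D≢1 eq) =
      level-form (suc N) P D (m≤n⇒m≤1+n 2P≤N) D≤3P D≢1 (trans (+-assoc a y D) (cong (a +_) eq))

    add-pair : ∀ {s y} e → s + e ≡ 2 * a → 2 ≤ e → e ≤ 3 → LevelForm y → LevelForm (s + y)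
    add-pair {s} {y} e s+e≡2a 2≤e e≤3 (level-form N P D 2P≤N D≤3P _ eq) =
      level-form (2 + N) (suc P) (e + D)
        (subst (_≤ 2 + N) (sym (*-suc 2 P)) (s≤s (s≤s 2P≤N)))
        (subst (e + D ≤_) (sym (*-suc 3 P)) (+-mono-≤ e≤3 D≤3P))
        (λ e+D≡1 → contradiction (subst (2 ≤_) e+D≡1 (≤-trans 2≤e (m≤m+n e D))) λ where (s≤s ()))
        (begin
          s + y + (e + D)      ≡⟨ interchange s y e D ⟩
          (s + e) + (y + D)    ≡⟨ cong₂ _+_ s+e≡2a eq ⟩
          2 * a + N * a        ≡⟨ *-distribʳ-+ a 2 N ⟨
          (2 + N) * a          ∎)
      where
      open ≡-Reasoning
      interchange : ∀ s y e D → s + y + (e + D) ≡ (s + e) + (y + D)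
      interchange = solve-∀

  ∈⇒LevelForm : ∀ {y} → G y → LevelForm y
  ∈⇒LevelForm gen-zero                                = level-form 0 0 0 z≤n z≤n (λ ()) refl
  ∈⇒LevelForm (gen-add (here refl) y∈G)                 = add-a (∈⇒LevelForm y∈G)
  ∈⇒LevelForm (gen-add (there (here refl)) y∈G)         =
    add-pair 3 b+3≡2a (s≤s (s≤s z≤n)) ≤-refl (∈⇒LevelForm y∈G)
  ∈⇒LevelForm (gen-add (there (there (here refl))) y∈G) =
    add-pair 2 c+2≡2a ≤-refl (n≤1+n 2) (∈⇒LevelForm y∈G)

  multiple-∈ : ∀ n → G (n * a)
  multiple-∈ = ⟨⟩-* (here refl)

  level-∈ : ∀ {y N P D} → 2 * P ≤ N → 2 ≤ D → D ≤ 3 * P → y + D ≡ N * a → G y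
  level-∈ {y} {N} {P} {D} 2P≤N 2≤D D≤3P eq
    with i , j , 3i+2j≡D , i+j≤P ← threes-and-twos D P 2≤D D≤3P =
    subst G combination≡y
      (⟨⟩-+ (⟨⟩-+ (multiple-∈ l) (⟨⟩-* (there (here refl)) i)) (⟨⟩-* (there (there (here refl))) j))
    where
    open ≡-Reasoning
    l : ℕ
    l = N ∸ 2 * (i + j)

    regroup : ∀ l i j a b c → l * a + i * b + j * c + (3 * i + 2 * j) ≡ l * a + i * (b + 3) + j * (c + 2)
    regroup = solve-∀

    collect : ∀ l i j a → l * a + i * (2 * a) + j * (2 * a) ≡ (l + 2 * (i + j)) * a
    collect = solve-∀

    combination≡y : l * a + i * b + j * c ≡ y
    combination≡y = +-cancelʳ-≡ D _ y (begin
      l * a + i * b + j * c + D                ≡⟨ cong (l * a + i * b + j * c +_) 3i+2j≡D ⟨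
      l * a + i * b + j * c + (3 * i + 2 * j)  ≡⟨ regroup l i j a b c ⟩
      l * a + i * (b + 3) + j * (c + 2)        ≡⟨ cong₂ (λ u v → l * a + i * u + j * v) b+3≡2a c+2≡2a ⟩
      l * a + i * (2 * a) + j * (2 * a)        ≡⟨ collect l i j a ⟩
      (l + 2 * (i + j)) * a                    ≡⟨ cong (_* a) (m∸n+n≡m (≤-trans (*-monoʳ-≤ 2 i+j≤P) 2P≤N)) ⟩
      N * a                                    ≡⟨ eq ⟨
      y + D                                    ∎)

  base : ℕ → ℕ
  base n = n * a + 3 * (k ∸ ⌈ n /2⌉)

  ⌈n/2⌉≤k : ∀ {n} → n ≤ 2 * k → ⌈ n /2⌉ ≤ k
  ⌈n/2⌉≤k n≤2k = subst (_ ≤_) (⌊1+2n/2⌋≡n k) (⌈n/2⌉-mono n≤2k)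

  base+3⌈n/2⌉ : ∀ {n} → n ≤ 2 * k → suc (base n + 3 * ⌈ n /2⌉) ≡ suc n * a
  base+3⌈n/2⌉ {n} n≤2k = begin
    suc (n * a + 3 * (k ∸ h) + 3 * h)     ≡⟨ cong suc (+-assoc (n * a) _ _) ⟩
    suc (n * a + (3 * (k ∸ h) + 3 * h))   ≡⟨ cong (λ x → suc (n * a + x)) (*-distribˡ-+ 3 (k ∸ h) h) ⟨
    suc (n * a + 3 * (k ∸ h + h))         ≡⟨ cong (λ x → suc (n * a + 3 * x)) (m∸n+n≡m (⌈n/2⌉≤k n≤2k)) ⟩
    suc (n * a + 3 * k)                   ≡⟨ reorder (n * a) k ⟩
    suc n * a                             ∎
    where
    open ≡-Reasoning
    h = ⌈ n /2⌉
    reorder : ∀ u k → suc (u + 3 * k) ≡ 3 * k + 1 + u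
    reorder = solve-∀

  base[2k] : base (2 * k) ≡ 2 * k * a
  base[2k] = begin
    2 * k * a + 3 * (k ∸ ⌈ 2 * k /2⌉)   ≡⟨ cong (λ x → 2 * k * a + 3 * (k ∸ x)) (⌊1+2n/2⌋≡n k) ⟩
    2 * k * a + 3 * (k ∸ k)             ≡⟨ cong (λ x → 2 * k * a + 3 * x) (n∸n≡0 k) ⟩
    2 * k * a + 0                       ≡⟨ +-identityʳ _ ⟩
    2 * k * a                           ∎
    where open ≡-Reasoning

  interior-∈ : ∀ {n r} → n ≤ 2 * k → 1 ≤ r → r < 3 * ⌈ n /2⌉ → G (base n + r)
  interior-∈ {n} {r} n≤2k 1≤r r<3h with d , 1+r+d≡3h ← m≤n⇒∃[o]m+o≡n r<3h =
    level-∈ {P = ⌈ n /2⌉} (2*⌊n/2⌋≤n (suc n)) (s≤s (s≤s z≤n))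
      (subst (2 + d ≤_) 1+r+d≡3h (+-monoˡ-≤ d (s≤s 1≤r))) (begin
        base n + r + suc (suc d)      ≡⟨ reorder (base n) r d ⟩
        suc (base n + (suc r + d))    ≡⟨ cong (λ x → suc (base n + x)) 1+r+d≡3h ⟩
        suc (base n + 3 * ⌈ n /2⌉)    ≡⟨ base+3⌈n/2⌉ n≤2k ⟩
        suc n * a                     ∎)
    where
    open ≡-Reasoning
    reorder : ∀ u r d → u + r + suc (suc d) ≡ suc (u + (suc r + d))
    reorder = solve-∀

  [2k+1]a∸1-∈ : G (2 * k * a + 3 * k)
  [2k+1]a∸1-∈ = level-∈ {N = 2 + 2 * k} {P = suc k} (≤-reflexive (*-suc 2 k)) (m≤n+m 2 (3 * k))
                   (subst (3 * k + 2 ≤_) (tripled k) (n≤1+n _)) (identity k)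
    where
    tripled : ∀ k → suc (3 * k + 2) ≡ 3 * suc k
    tripled = solve-∀
    identity : ∀ k → 2 * k * (3 * k + 1) + 3 * k + (3 * k + 2) ≡ (2 + 2 * k) * (3 * k + 1)
    identity = solve-∀

  private
    below-a-∈ : ∀ r → r ≤ 3 * k → G (2 * k * a + r)
    below-a-∈ zero    _ = subst G (sym (+-identityʳ _)) (multiple-∈ (2 * k))
    below-a-∈ (suc r) 1+r≤3k with suc r <? 3 * k
    ... | yes 1+r<3k = subst (λ u → G (u + suc r)) base[2k]
                         (interior-∈ ≤-refl (s≤s z≤n) (subst (λ h → suc r < 3 * h) (sym (⌊1+2n/2⌋≡n k)) 1+r<3k))
    ... | no  1+r≮3k = subst (λ r → G (2 * k * a + r)) (≤-antisym (≮⇒≥ 1+r≮3k) 1+r≤3k) [2k+1]a∸1-∈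

  tail-∈ : ∀ {x} → 2 * k * a ≤ x → G x
  tail-∈ {x} 2ka≤x with d , 2ka+d≡x ← m≤n⇒∃[o]m+o≡n 2ka≤x =
    subst G (trans regroup 2ka+d≡x) (⟨⟩-+ (below-a-∈ (d % a) r≤3k) (multiple-∈ (d / a)))
    where
    r≤3k : d % a ≤ 3 * k
    r≤3k = +-cancelʳ-≤ 1 _ _ (subst (_≤ a) (+-comm 1 (d % a)) (m%n<n d a))
    regroup : 2 * k * a + d % a + d / a * a ≡ 2 * k * a + d
    regroup = trans (+-assoc (2 * k * a) _ _) (cong (2 * k * a +_) (sym (m≡m%n+[m/n]*n d a)))

  private
    overshoot : ∀ {k} → 1 ≤ k → ∀ M → 3 * (suc (2 * k) + M) < 2 * suc (suc M * (3 * k + 1))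
    overshoot {suc k} _ M = subst (suc (3 * (suc (2 * suc k) + M)) ≤_) (identity k M) (m≤m+n _ _)
      where
      identity : ∀ k M → suc (3 * (suc (2 * suc k) + M)) + (6 * k * M + 5 * M)
                       ≡ 2 * suc (suc M * (3 * suc k + 1))
      identity = solve-∀

  -- A level N ≥ n + 2 would need a deficit above (N − n − 1)·a, more than 3N/2 when n < 2k.
  window-level : ∀ {n y N D} → suc n ≤ 2 * k → n * a < y → y < suc n * a →
           y + D ≡ N * a → 2 * D ≤ 3 * N → N ≡ suc n
  window-level {n} {y} {N} {D} 1+n≤2k na<y y<[1+n]a eq 2D≤3N with <-cmp N (suc n)
  ... | tri≈ _ N≡1+n _ = N≡1+n
  ... | tri< N<1+n _ _ = contradiction (begin-strict
        y        ≤⟨ m≤m+n y D ⟩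
        y + D    ≡⟨ eq ⟩
        N * a    ≤⟨ *-monoˡ-≤ a (s≤s⁻¹ N<1+n) ⟩
        n * a    <⟨ na<y ⟩
        y        ∎) (<-irrefl refl)
    where open ≤-Reasoning
  ... | tri> _ _ 1+n<N with M , 2+n+M≡N ← m≤n⇒∃[o]m+o≡n 1+n<N =
    contradiction (begin
        2 * suc (suc M * a)           ≤⟨ *-monoʳ-≤ 2 [1+M]a<D ⟩
        2 * D                         ≤⟨ 2D≤3N ⟩
        3 * N                         ≡⟨ cong (3 *_) 2+n+M≡N ⟨
        3 * (suc (suc n) + M)         ≤⟨ *-monoʳ-≤ 3 (+-monoˡ-≤ M (s≤s 1+n≤2k)) ⟩
        3 * (suc (2 * k) + M)         ∎) (<⇒≱ (overshoot 1≤k M))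
    where
    open ≤-Reasoning
    [1+M]a<D : suc M * a < D
    [1+M]a<D = +-cancelˡ-< (suc n * a) _ _ (begin-strict
      suc n * a + suc M * a     ≡⟨ *-distribʳ-+ a (suc n) (suc M) ⟨
      (suc n + suc M) * a       ≡⟨ cong (_* a) (trans (+-suc (suc n) M) 2+n+M≡N) ⟩
      N * a                     ≡⟨ eq ⟨
      y + D                     <⟨ +-monoˡ-< D y<[1+n]a ⟩
      suc n * a + D             ∎)

  window-deficit : ∀ {n y} → suc n ≤ 2 * k → n * a < y → y < suc n * a → G y →
           ∃[ D ] y + D ≡ suc n * a × 2 ≤ D × D ≤ 3 * ⌈ n /2⌉
  window-deficit {n} {y} 1+n≤2k na<y y<[1+n]a y∈G = deficit , y+D≡[1+n]a , 2≤D , D≤3⌈n/2⌉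
    where
    form = ∈⇒LevelForm y∈G
    open LevelForm form

    level≡1+n : level ≡ suc n
    level≡1+n = window-level 1+n≤2k na<y y<[1+n]a y+deficit≡level*a (2*deficit≤3*level form)

    y+D≡[1+n]a : y + deficit ≡ suc n * a
    y+D≡[1+n]a = trans y+deficit≡level*a (cong (_* a) level≡1+n)

    D≢0 : deficit ≢ 0
    D≢0 D≡0 = <⇒≢ y<[1+n]a (trans (sym (+-identityʳ y)) (subst (λ d → y + d ≡ _) D≡0 y+D≡[1+n]a))

    2≤D : 2 ≤ deficit
    2≤D = ≤∧≢⇒< (n≢0⇒n>0 D≢0) (deficit≢1 ∘ sym)

    D≤3⌈n/2⌉ : deficit ≤ 3 * ⌈ n /2⌉
    D≤3⌈n/2⌉ = ≤-trans deficit≤3*half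
      (*-monoʳ-≤ 3 (2*m≤n⇒m≤⌊n/2⌋ {half} (subst (2 * half ≤_) level≡1+n 2*half≤level)))

  after-multiple-∉ : ∀ {n w} → suc n ≤ 2 * k → n * a < w → w ≤ base n → ¬ G w
  after-multiple-∉ {n} {w} 1+n≤2k na<w w≤base w∈G =
    let D , w+D≡[1+n]a , _ , D≤3h = window-deficit 1+n≤2k na<w (≤-<-trans w≤base base<[1+n]a) w∈G
    in <-irrefl refl (begin-strict
      suc n * a                   ≡⟨ w+D≡[1+n]a ⟨
      w + D                       ≤⟨ +-mono-≤ w≤base D≤3h ⟩
      base n + 3 * ⌈ n /2⌉        <⟨ n<1+n _ ⟩
      suc (base n + 3 * ⌈ n /2⌉)  ≡⟨ base+3⌈n/2⌉ (<⇒≤ 1+n≤2k) ⟩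
      suc n * a                   ∎)
    where
    open ≤-Reasoning
    base<[1+n]a : base n < suc n * a
    base<[1+n]a = subst (base n <_) (base+3⌈n/2⌉ (<⇒≤ 1+n≤2k)) (s≤s (m≤m+n (base n) _))

  before-multiple-∉ : ∀ {n y} → suc n ≤ 2 * k → suc y ≡ suc n * a → ¬ G y
  before-multiple-∉ {n} {y} 1+n≤2k 1+y≡[1+n]a y∈G =
    let D , y+D≡[1+n]a , 2≤D , _ = window-deficit 1+n≤2k na<y (subst (y <_) 1+y≡[1+n]a (n<1+n y)) y∈G
        D≡1 = +-cancelˡ-≡ y D 1 (trans y+D≡[1+n]a (trans (sym 1+y≡[1+n]a) (+-comm 1 y)))
    in contradiction (subst (2 ≤_) D≡1 2≤D) λ where (s≤s ())
    where
    2≤a : 2 ≤ a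
    2≤a = ≤-trans (s≤s (s≤s z≤n)) (+-monoˡ-≤ 1 (*-monoʳ-≤ 3 1≤k))
    na<y : n * a < y
    na<y = s≤s⁻¹ (subst (2 + n * a ≤_) (sym 1+y≡[1+n]a) (+-monoˡ-≤ (n * a) 2≤a))

  -- Position (n , t) is the t-th triple of G ∩ [n·a, (n+1)·a), which for n < 2k is n·a
  -- followed by base n + 1, …, base n + 3⌈n/2⌉ − 1; from n = 2k on G contains everything,
  -- and block 2k is never left.
  low mid high : ℕ × ℕ → ℕ
  low (n , zero)  = n * a
  low (n , suc t) = base n + 3 * suc t
  mid (n , t)     = base n + suc (3 * t)
  high (n , t)    = base n + suc (suc (3 * t))

  next : ℕ × ℕ → ℕ × ℕ
  next (n , t) with n <? 2 * k | suc t <? ⌈ n /2⌉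
  ... | yes _ | no _ = suc n , 0
  ... | _     | _    = n , suc t

  data Reachable : ℕ × ℕ → Set where
    inside : ∀ {n t} → n < 2 * k → t < ⌈ n /2⌉ → Reachable (n , t)
    beyond : ∀ {t} → Reachable (2 * k , t)

  first-reachable : ∀ {n} → suc n ≤ 2 * k → Reachable (suc n , 0)
  first-reachable {n} 1+n≤2k with suc n <? 2 * k
  ... | yes 1+n<2k = inside 1+n<2k (s≤s z≤n)
  ... | no  1+n≮2k = subst (λ m → Reachable (m , 0)) (sym (≤-antisym 1+n≤2k (≮⇒≥ 1+n≮2k))) beyond

  next-reachable : ∀ {p} → Reachable p → Reachable (next p)
  next-reachable (inside {n} {t} n<2k t<h) with n <? 2 * k | suc t <? ⌈ n /2⌉
  ... | no n≮2k | _         = contradiction n<2k n≮2k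
  ... | yes _   | yes 1+t<h = inside n<2k 1+t<h
  ... | yes _   | no _      = first-reachable n<2k
  next-reachable (beyond {t}) with 2 * k <? 2 * k | suc t <? ⌈ 2 * k /2⌉
  ... | yes 2k<2k | _ = contradiction 2k<2k (<-irrefl refl)
  ... | no _      | _ = beyond

  position : ℕ → ℕ × ℕ
  position zero    = 1 , 0
  position (suc m) = next (position m)

  position-reachable : ∀ m → Reachable (position m)
  position-reachable zero    = first-reachable (≤-trans (s≤s z≤n) (*-monoʳ-≤ 2 1≤k))
  position-reachable (suc m) = next-reachable (position-reachable m)

  offset-∈ : ∀ {n t r} → Reachable (n , t) → 1 ≤ r → r ≤ 2 + 3 * t → G (base n + r)
  offset-∈ {n} {t} (inside n<2k t<h) 1≤r r≤2+3t =
    interior-∈ (<⇒≤ n<2k) 1≤r (≤-<-trans r≤2+3t (subst (_≤ 3 * ⌈ n /2⌉) (*-suc 3 t) (*-monoʳ-≤ 3 t<h)))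
  offset-∈ {r = r} beyond _ _ = subst G (cong (_+ r) (sym base[2k])) (tail-∈ (m≤m+n _ r))

  low-∈ : ∀ {p} → Reachable p → G (low p)
  low-∈ {n , zero}  _ = multiple-∈ n
  low-∈ {n , suc t} p = offset-∈ p (s≤s z≤n) (m≤n+m _ 2)

  mid-∈ : ∀ {p} → Reachable p → G (mid p)
  mid-∈ p = offset-∈ p (s≤s z≤n) (n≤1+n _)

  high-∈ : ∀ {p} → Reachable p → G (high p)
  high-∈ p = offset-∈ p (s≤s z≤n) ≤-refl

  low→mid : ∀ {p} → Reachable p → Consecutive G (low p) (mid p)
  low→mid {n , suc t} _ = consecutive-suc (+-suc (base n) (3 * suc t))
  low→mid {n , zero} (inside n<2k _) =
    ≤-<-trans (m≤m+n (n * a) _) (m<m+n (base n) (s≤s z≤n)) ,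
    λ w na<w w<base+1 → after-multiple-∉ n<2k na<w (s≤s⁻¹ (subst (w <_) (+-comm (base n) 1) w<base+1))
  low→mid {_ , zero} beyond = consecutive-suc (trans (+-comm (base (2 * k)) 1) (cong suc base[2k]))

  mid→high : ∀ p → Consecutive G (mid p) (high p)
  mid→high (n , t) = consecutive-suc (+-suc (base n) _)

  low[n,1+t]≡1+high[n,t] : ∀ n t → low (n , suc t) ≡ suc (high (n , t))
  low[n,1+t]≡1+high[n,t] n t = identity (base n) t
    where
    identity : ∀ u t → u + 3 * suc t ≡ suc (u + suc (suc (3 * t)))
    identity = solve-∀

  high→low : ∀ {p} → Reachable p → Consecutive G (high p) (low (next p))
  high→low (inside {n} {t} n<2k t<h) with n <? 2 * k | suc t <? ⌈ n /2⌉
  ... | yes _ | yes _  = consecutive-suc (low[n,1+t]≡1+high[n,t] n t)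
  ... | yes _ | no 1+t≮h = consecutive-skip [1+n]a≡2+high (before-multiple-∉ n<2k (sym [1+n]a≡2+high))
    where
    [1+n]a≡2+high : suc n * a ≡ suc (suc (high (n , t)))
    [1+n]a≡2+high = begin
      suc n * a                         ≡⟨ base+3⌈n/2⌉ (<⇒≤ n<2k) ⟨
      suc (base n + 3 * ⌈ n /2⌉)        ≡⟨ cong (λ h → suc (base n + 3 * h)) (≤-antisym (≮⇒≥ 1+t≮h) t<h) ⟩
      suc (low (n , suc t))             ≡⟨ cong suc (low[n,1+t]≡1+high[n,t] n t) ⟩
      suc (suc (high (n , t)))          ∎
      where open ≡-Reasoning
  ... | no n≮2k | _ = contradiction n<2k n≮2k
  high→low (beyond {t}) with 2 * k <? 2 * k | suc t <? ⌈ 2 * k /2⌉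
  ... | yes 2k<2k | _ = contradiction 2k<2k (<-irrefl refl)
  ... | no _      | _ = consecutive-suc (low[n,1+t]≡1+high[n,t] (2 * k) t)

  0→low : Consecutive G 0 (low (1 , 0))
  0→low = subst (0 <_) (sym (*-identityˡ a)) 0<a ,
          λ w 0<w w<a → after-multiple-∉ (≤-trans (s≤s z≤n) (*-monoʳ-≤ 2 1≤k)) 0<w (w≤3k w<a)
    where
    w≤3k : ∀ {w} → w < 1 * a → w ≤ 3 * k
    w≤3k {w} w<a = +-cancelʳ-≤ 1 w (3 * k) (subst (_≤ a) (+-comm 1 w) (subst (w <_) (*-identityˡ a) w<a))

  mid≡low+1+3w : ∀ p → ∃[ w ] mid p ≡ low p + 1 + w * 3
  mid≡low+1+3w (n , zero)  = k ∸ ⌈ n /2⌉ , identity (n * a) (k ∸ ⌈ n /2⌉)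
    where
    identity : ∀ u e → u + 3 * e + 1 ≡ u + 1 + e * 3
    identity = solve-∀
  mid≡low+1+3w (n , suc t) = 0 , identity (base n) (3 * suc t)
    where
    identity : ∀ u v → u + suc v ≡ u + v + 1 + 0 * 3
    identity = solve-∀

  mid-residue : ∀ p → mid p % 3 ≡ (low p + 1) % 3
  mid-residue p with w , mid≡ ← mid≡low+1+3w p = trans (cong (_% 3) mid≡) ([m+kn]%n≡m%n (low p + 1) w 3)

  high-residue : ∀ p → high p % 3 ≡ (low p + 2) % 3
  high-residue p@(n , t) with w , mid≡ ← mid≡low+1+3w p =
    trans (cong (_% 3) (trans (+-suc (base n) _) (trans (cong suc mid≡) (identity (low p) w))))
          ([m+kn]%n≡m%n (low p + 2) w 3)
    where
    identity : ∀ u w → suc (u + 1 + w * 3) ≡ u + 2 + w * 3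
    identity = solve-∀

  first-generators : low (1 , 0) ∷ mid (1 , 0) ∷ high (1 , 0) ∷ [] ≡ a ∷ b ∷ c ∷ []
  first-generators = cong₂ _∷_ (*-identityˡ a) (cong₂ _∷_ mid≡b (cong₂ _∷_ high≡c refl))
    where
    open ≡-Reasoning
    k∸1+1≡k : k ∸ 1 + 1 ≡ k
    k∸1+1≡k = m∸n+n≡m 1≤k

    identity : ∀ e → 1 * (3 * (e + 1) + 1) + 3 * e + 2 ≡ 6 * (e + 1)
    identity = solve-∀

    high≡c : high (1 , 0) ≡ c
    high≡c = begin
      1 * a + 3 * (k ∸ 1) + 2                     ≡⟨ cong (λ x → 1 * (3 * x + 1) + 3 * (k ∸ 1) + 2) k∸1+1≡k ⟨
      1 * (3 * (k ∸ 1 + 1) + 1) + 3 * (k ∸ 1) + 2 ≡⟨ identity (k ∸ 1) ⟩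
      6 * (k ∸ 1 + 1)                             ≡⟨ cong (6 *_) k∸1+1≡k ⟩
      6 * k                                       ∎

    mid≡b : mid (1 , 0) ≡ b
    mid≡b = cong (_∸ 1) (trans (sym (+-suc (base 1) 1)) high≡c)

lemma4p6 : (k : ℕ) → 1 ≤ k →
    IsNPermutationNS 3 ⟨ (3 * k + 1) ∷ (6 * k ∸ 1) ∷ (6 * k) ∷ [] ⟩
lemma4p6 k 1≤k =
    (⟨⟩-isSubmonoid , 2 * k * a , λ _ → tail-∈)
  , enumeration
  , consecutive⇒enumeration refl
      (enumeration-all {G} gen-zero
        (low-∈ ∘ position-reachable) (mid-∈ ∘ position-reachable) (high-∈ ∘ position-reachable))
      (enumeration-consecutive 0→low
        (low→mid ∘ position-reachable) (mid→high ∘ position) (high→low ∘ position-reachable))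
  , (λ x → subst (λ S → ⟨ S ⟩ x) (sym first-generators) , subst (λ S → ⟨ S ⟩ x) first-generators)
  , enumeration-residues (mid-residue ∘ position) (high-residue ∘ position)
  where
  open Semigroup k 1≤k
  open Interleaving (low ∘ position) (mid ∘ position) (high ∘ position)
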